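{- Let $\mathbf{s}=(s_i)_{i\in\omega}$ be a sequence of pairwise disjoint elements of $\mathbb{F}$ such that for every $n$ there exist $i_0<\dots<i_n$ for which the meshing graph $G_{(s_{i_0},\ldots,s_{i_n})}$ is complete. If $A\subseteq\mathbb{F}$ is $\mathbf{s}$-meshed, then there is no ordered sequence $\mathbf{t}$ with $\mathbf{t}\sqsubseteq\mathbf{s}$ and $A\subseteq FU(\mathbf{t})$.
   Context: $\mathbb{F}$ denotes the set of nonempty finite subsets of $\omega$. For $s,t\in\mathbb{F}$ write $s<t$ iff $\max(s)<\min(t)$, and say $s,t$ mesh, $s\sqcap t$, if neither $s<t$ nor $t<s$. A sequence $(x_i)$ is ordered if $x_i<x_j$ whenever $i<j$. For a sequence $\mathbf{x}=(x_i)_{i<N}$ ($N\le\omega$) of pairwise disjoint elements of $\mathbb{F}$, $FU(\mathbf{x})=\{\bigcup_{i\in v}x_i : v \text{ a nonempty finite subset of } N\}$, and $\mathbf{y}\sqsubseteq\mathbf{x}$ means $FU(\mathbf{y})\subseteq FU(\mathbf{x})$. For $z\in FU(\mathbf{s})$, the $\mathbf{s}$-support of $z$ is the unique finite set $v$ with $z=\bigcup_{i\in v}s_i$; "$s_n\subseteq t$" below means $n$ is in the $\mathbf{s}$-support of $t$. Given a finite or infinite sequence $\mathbf{t}=(t_j)_{j<K}$ of pairwise disjoint elements with $\mathbf{t}\sqsubseteq\mathbf{s}$, the meshing graph $G_{\mathbf{t}}$ has vertex set $\{t_j:j<K\}$ and an edge $\{t_i,t_j\}$ whenever there are $s_n\subseteq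 t_i$ and $s_m\subseteq t_j$ with $s_n\sqcap s_m$. A set $A\subseteq\mathbb{F}$ is $\mathbf{s}$-meshed if for every $n\in\omega$ there is a sequence $\mathbf{t}=(t_i)_{i<n}$ of pairwise disjoint elements of $\mathbb{F}$ with $FU(\mathbf{t})\subseteq FU(\mathbf{s})\cap A$ and $G_{\mathbf{t}}$ a complete graph. -}

module Defs where

open import Data.Nat using (ℕ; _≤_; _<_)
open import Data.Bool using (Bool; true; false)
open import Data.List using (List; [])
open import Data.Bool.ListAction using (any)
open import Data.Fin using (Fin)
open import Data.List.Membership.Propositional using (_∈_)
open import Data.Product using (Σ; ∃; ∃₂; _×_)
open import Data.Empty using (⊥)
open import Relation.Nullary using (¬_)
open import Relation.Binary.PropositionalEquality using (_≡_; _≢_)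

SubsetΩ : Set
SubsetΩ = ℕ → Bool

_∈ₛ_ : ℕ → SubsetΩ → Set
n ∈ₛ x = x n ≡ true

_≐_ : SubsetΩ → SubsetΩ → Set
x ≐ y = ∀ n → x n ≡ y n

IsF : SubsetΩ → Set
IsF x = (∃ λ n → n ∈ₛ x) × (∃ λ b → ∀ n → b ≤ n → x n ≡ false)

-- s < t  iff  max s < min t  (for nonempty s, t: every element of s is below every element of t)
_<F_ : SubsetΩ → SubsetΩ → Set
x <F y = ∀ a b → a ∈ₛ x → b ∈ₛ y → a < b

Mesh : SubsetΩ → SubsetΩ → Set
Mesh x y = ¬ (x <F y) × ¬ (y <F x)

-- a sequence indexed by I (I = ℕ for ω, I = Fin N for finite N) of pairwise disjoint elements of 𝔽
PairwiseDisjoint : {I : Set} → (I → SubsetΩ) → Set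
PairwiseDisjoint {I} x = ∀ (i j : I) → i ≢ j → ∀ n → n ∈ₛ x i → n ∈ₛ x j → ⊥

IsSeq : {I : Set} → (I → SubsetΩ) → Set
IsSeq {I} x = (∀ (i : I) → IsF (x i)) × PairwiseDisjoint x

⋃ : {I : Set} → (I → SubsetΩ) → List I → SubsetΩ
⋃ x v n = any (λ i → x i n) v

InFU : {I : Set} → (I → SubsetΩ) → SubsetΩ → Set
InFU {I} x z = Σ (List I) λ v → (v ≢ []) × (z ≐ ⋃ x v)

_⊑_ : {I J : Set} → (J → SubsetΩ) → (I → SubsetΩ) → Set
y ⊑ x = ∀ z → InFU y z → InFU x z

-- "s_n ⊆ t": n belongs to the s-support of t
InSupport : (ℕ → SubsetΩ) → ℕ → SubsetΩ → Set
InSupport s n t = Σ (List ℕ) λ v → (t ≐ ⋃ s v) × (n ∈ v)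

Edge : {I : Set} → (ℕ → SubsetΩ) → (I → SubsetΩ) → I → I → Set
Edge s t i j = ∃₂ λ n m → InSupport s n (t i) × InSupport s m (t j) × Mesh (s n) (s m)

Complete : {I : Set} → (ℕ → SubsetΩ) → (I → SubsetΩ) → Set
Complete {I} s t = ∀ (i j : I) → i ≢ j → Edge s t i j

Meshed : (ℕ → SubsetΩ) → (SubsetΩ → Set) → Set
Meshed s A = ∀ (n : ℕ) → Σ (Fin n → SubsetΩ) λ t →
  IsSeq t × (∀ z → InFU t z → InFU s z × A z) × Complete s t

Ordered : {I : Set} → (I → I → Set) → (I → SubsetΩ) → Set
Ordered {I} _≺_ t = ∀ (i j : I) → i ≺ j → t i <F t j

module Submission where

-- The proof rests on one observation: an s-block
-- s_n meeting a member u of FU(t) lies inside a single t_i ⊆ u (s_n meets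
-- some t_i ⊆ u, and t_i is a union of s-blocks, which are disjoint).  Hence
-- if u, u' ∈ FU(t) are disjoint and s_n ⊆ u, s_m ⊆ u' mesh, then
-- s_n ⊆ t_i ⊆ u and s_m ⊆ t_j ⊆ u'; since t is ordered, meshing forces
-- i = j, so t_i lies in both u and u', contradicting disjointness.  So the
-- meshing graph of a disjoint family inside FU(t) has no edges.  An s-meshed
-- set A contains (the FU of) a disjoint pair whose meshing graph is an edge,
-- so A ⊄ FU(t).

open import Defs
open import Data.Nat using (ℕ; suc; _<_)
open import Data.Fin using (Fin)
import Data.Fin
open import Data.Product using (Σ; _×_)
open import Function using (_∘_)
open import Relation.Nullary using (¬_)

open import Data.Bool.Properties using (∨-identityʳ; T-≡)
open import Data.Empty using (⊥-elim)
open import Data.Fin.Patterns using (0F; 1F)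
import Data.Fin.Properties as Fin
open import Data.List using (List; []; _∷_)
open import Data.List.Membership.Propositional using (_∈_; find; lose)
open import Data.List.Relation.Unary.Any.Properties using (any⁺; any⁻)
import Data.Nat.Properties as ℕ
open import Data.Product using (∃; _,_; proj₁; proj₂)
open import Function.Bundles using (Equivalence)
open import Relation.Binary.Definitions using (Trichotomous; tri<; tri≈; tri>)
open import Relation.Binary.PropositionalEquality using (_≡_; _≢_; refl; sym; trans)
open import Relation.Nullary using (yes; no)

open Equivalence using (to; from)

_⊆ₛ_ : SubsetΩ → SubsetΩ → Set
x ⊆ₛ y = ∀ a → a ∈ₛ x → a ∈ₛ y

∈⋃-intro : {I : Set} (x : I → SubsetΩ) {v : List I} {i : I} {a : ℕ}
         → i ∈ v → a ∈ₛ x i → a ∈ₛ ⋃ x v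
∈⋃-intro x i∈v a∈xi = to T-≡ (any⁺ _ (lose i∈v (from T-≡ a∈xi)))

∈⋃-elim : {I : Set} (x : I → SubsetΩ) (v : List I) {a : ℕ}
        → a ∈ₛ ⋃ x v → ∃ λ i → i ∈ v × a ∈ₛ x i
∈⋃-elim x v a∈⋃ with find (any⁻ _ v (from T-≡ a∈⋃))
... | i , i∈v , a∈xi = i , i∈v , to T-≡ a∈xi

term∈FU : {I : Set} (x : I → SubsetΩ) (i : I) → InFU x (x i)
term∈FU x i = i ∷ [] , (λ ()) , λ a → sym (∨-identityʳ (x i a))

support⊆ : (s : ℕ → SubsetΩ) {n : ℕ} {z : SubsetΩ} → InSupport s n z → s n ⊆ₛ z
support⊆ s (v , z≐⋃ , n∈v) a a∈sn = trans (z≐⋃ a) (∈⋃-intro s n∈v a∈sn)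

block⊆ : (s : ℕ → SubsetΩ) → PairwiseDisjoint s → {z : SubsetΩ} → InFU s z
       → {n a : ℕ} → a ∈ₛ s n → a ∈ₛ z → s n ⊆ₛ z
block⊆ s disj (w , _ , z≐⋃) {n} a∈sn a∈z with ∈⋃-elim s w (trans (sym (z≐⋃ _)) a∈z)
... | j , j∈w , a∈sj with j ℕ.≟ n
...   | no j≢n    = ⊥-elim (disj j n j≢n _ a∈sj a∈sn)
...   | yes refl  = λ b b∈sn → trans (z≐⋃ b) (∈⋃-intro s j∈w b∈sn)

mesh⇒sameTerm : {I : Set} {_≺_ : I → I → Set} → Trichotomous _≡_ _≺_
              → (t : I → SubsetΩ) → Ordered _≺_ t
              → {x y : SubsetΩ} {i j : I} → x ⊆ₛ t i → y ⊆ₛ t j → Mesh x y → i ≡ j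
mesh⇒sameTerm tri t ord {i = i} {j} x⊆ti y⊆tj (x≮y , y≮x) with tri i j
... | tri< i≺j _ _ = ⊥-elim (x≮y λ a b a∈x b∈y → ord i j i≺j a b (x⊆ti a a∈x) (y⊆tj b b∈y))
... | tri≈ _ i≡j _ = i≡j
... | tri> _ _ j≺i = ⊥-elim (y≮x λ a b a∈y b∈x → ord j i j≺i a b (y⊆tj a a∈y) (x⊆ti b b∈x))

module OrderedBelow (s : ℕ → SubsetΩ) (hs : IsSeq s)
  {I : Set} {_≺_ : I → I → Set} (tri : Trichotomous _≡_ _≺_)
  (t : I → SubsetΩ) (ord : Ordered _≺_ t) (t⊑s : t ⊑ s) where

  blockInTerm : {u : SubsetΩ} → InFU t u → {n a : ℕ} → a ∈ₛ s n → a ∈ₛ u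
              → ∃ λ i → s n ⊆ₛ t i × t i ⊆ₛ u
  blockInTerm (w , _ , u≐⋃) a∈sn a∈u with ∈⋃-elim t w (trans (sym (u≐⋃ _)) a∈u)
  ... | i , i∈w , a∈ti =
    i , block⊆ s (proj₂ hs) (t⊑s (t i) (term∈FU t i)) a∈sn a∈ti
      , λ b b∈ti → trans (u≐⋃ b) (∈⋃-intro t i∈w b∈ti)

  noEdge : {J : Set} (u : J → SubsetΩ) → PairwiseDisjoint u → (∀ k → InFU t (u k))
         → ∀ k l → k ≢ l → ¬ Edge s u k l
  noEdge u udisj u∈FU k l k≢l (n , m , n∈uk , m∈ul , sn⊓sm)
    with proj₁ (proj₁ hs n) | proj₁ (proj₁ hs m)
  ... | a , a∈sn | b , b∈sm
    with blockInTerm (u∈FU k) a∈sn (support⊆ s n∈uk a a∈sn)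
       | blockInTerm (u∈FU l) b∈sm (support⊆ s m∈ul b b∈sm)
  ... | i , sn⊆ti , ti⊆uk | j , sm⊆tj , tj⊆ul
    with mesh⇒sameTerm tri t ord sn⊆ti sm⊆tj sn⊓sm
  ... | refl = udisj k l k≢l a (ti⊆uk a a∈ti) (tj⊆ul a a∈ti)
    where a∈ti = sn⊆ti a a∈sn

  meshedNotCovered : (A : SubsetΩ → Set) → Meshed s A → ¬ (∀ z → A z → InFU t z)
  meshedNotCovered A meshed A⊆FUt with meshed 2
  ... | u , (_ , udisj) , FUu⊆A , complete =
    noEdge u udisj (λ k → A⊆FUt (u k) (proj₂ (FUu⊆A (u k) (term∈FU u k))))
           0F 1F (λ ()) (complete 0F 1F (λ ()))

mainTheorem6 : (s : ℕ → SubsetΩ) → IsSeq s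
    → (∀ (n : ℕ) → Σ (Fin (suc n) → ℕ) λ idx →
    (∀ (a b : Fin (suc n)) → a Data.Fin.< b → idx a < idx b) × Complete s (s ∘ idx))
    → (A : SubsetΩ → Set) → (∀ z → A z → IsF z) → Meshed s A
    → ((t : ℕ → SubsetΩ) → IsSeq t → Ordered _<_ t → t ⊑ s → ¬ (∀ z → A z → InFU t z))
    × ((K : ℕ) → (t : Fin K → SubsetΩ) → IsSeq t → Ordered Data.Fin._<_ t → t ⊑ s
    → ¬ (∀ z → A z → InFU t z))
mainTheorem6 s hs _ A _ meshed =
  (λ t _ ord t⊑s → OrderedBelow.meshedNotCovered s hs ℕ.<-cmp t ord t⊑s A meshed) ,
  (λ K t _ ord t⊑s → OrderedBelow.meshedNotCovered s hs Fin.<-cmp t ord t⊑s A meshed)
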